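{- Let $p$ be a prime number. (a) If $n = 2p$ with $p > 2$, then $Mdim(\Gamma_E(\mathbb{Z}_n)) = 1$. (b) If $n = p^2$, then $Mdim(\Gamma_E(\mathbb{Z}_n)) = 0$.
   Context: $\mathbb{Z}_n$ is the ring of integers modulo $n$. For a commutative ring $R$ with identity $1\neq 0$, $Z(R)$ denotes its set of zero-divisors (including $0$). For $x\in R$ let $[x]=\{y\in R : \mathrm{ann}(x)=\mathrm{ann}(y)\}$. The compressed zero-divisor graph $\Gamma_E(R)$ is the simple graph whose vertices are the classes $[x]$ with $x\in Z(R)\setminus\{0\}$, distinct classes $[x],[y]$ being adjacent iff $xy=0$. For a connected graph $G$, a vertex $v$ and $W\subseteq V(G)$, the multiset representation of $v$ with respect to $W$ is the multiset $\{d(v,w): w\in W\}$ of distances (with multiplicities). $W$ is an m-resolving set if distinct vertices have distinct multiset representations. $Mdim(G)$ is the minimum cardinality of an m-resolving set, with $Mdim(G)=\infty$ if none exists; by convention $Mdim$ of a single-vertex graph is $0$. -}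

module Defs where

open import Data.Nat using (ℕ; zero; suc; _*_; _<_; _≤_)
open import Data.Nat.Divisibility using (_∣_)
open import Data.Fin using (Fin; toℕ)
open import Data.Product using (Σ; _×_; ∃)
open import Data.List using (List; length)
open import Data.List.Relation.Binary.Pointwise using (Pointwise)
open import Data.List.Relation.Binary.Permutation.Propositional using (_↭_)
open import Data.List.Relation.Unary.AllPairs using (AllPairs)
open import Relation.Binary.PropositionalEquality using (_≡_; _≢_)
open import Relation.Nullary using (¬_)

-- The ring ℤ_n is modelled by Fin n (residues 0,…,n-1) with multiplication
-- modulo n; "x * y = 0 in ℤ_n" is  n ∣ toℕ x * toℕ y.
module _ (n : ℕ) where

  MulZero : Fin n → Fin n → Set
  MulZero x y = n ∣ (toℕ x * toℕ y)

  ZeroDivisor : Fin n → Set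
  ZeroDivisor x = Σ (Fin n) λ y → toℕ y ≢ 0 × MulZero x y

  SameAnn : Fin n → Fin n → Set
  SameAnn x y = ∀ (z : Fin n) → (MulZero x z → MulZero y z) × (MulZero y z → MulZero x z)

  -- Representatives of vertices of Γ_E(ℤ_n): nonzero zero-divisors.
  -- A vertex [x] is represented by x; two representatives denote the same
  -- vertex iff SameAnn holds.
  Vtx : Set
  Vtx = Σ (Fin n) λ x → ZeroDivisor x × toℕ x ≢ 0

  elt : Vtx → Fin n
  elt v = Data.Product.proj₁ v

  SameV : Vtx → Vtx → Set
  SameV u v = SameAnn (elt u) (elt v)

  Adj : Vtx → Vtx → Set
  Adj u v = ¬ SameV u v × MulZero (elt u) (elt v)

  data Walk : ℕ → Vtx → Vtx → Set where
    here : ∀ {u v} → SameV u v → Walk zero u v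
    step : ∀ {k u w v} → Adj u w → Walk k w v → Walk (suc k) u v

  Dist : Vtx → Vtx → ℕ → Set
  Dist u v k = Walk k u v × (∀ j → j < k → ¬ Walk j u v)

  SameRep : List Vtx → Vtx → Vtx → Set
  SameRep W u v = Σ (List ℕ) λ ds → Σ (List ℕ) λ es →
    Pointwise (λ w d → Dist u w d) W ds ×
    Pointwise (λ w e → Dist v w e) W es × ds ↭ es

  IsVertexSet : List Vtx → Set
  IsVertexSet W = AllPairs (λ a b → ¬ SameV a b) W

  MResolving : List Vtx → Set
  MResolving W = ∀ u v → SameRep W u v → SameV u v

  MdimIs : ℕ → Set
  MdimIs k =
    (Σ (List Vtx) λ W → IsVertexSet W × length W ≡ k × MResolving W) ×
    (∀ W → IsVertexSet W → MResolving W → k ≤ length W)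

{-# OPTIONS --safe #-}
module Submission where

-- In ℤ_{mq} with q prime, every nonzero multiple x = a·m of m has 0 < a < q, so q ∤ a
-- and Euclid's lemma gives ann(x) = qℤ: all nonzero multiples of m form a single
-- class of Γ_E.  For n = p² every nonzero zero-divisor is a multiple of p, so Γ_E(ℤ_n)
-- is a single vertex.  For n = 2p the even residues form the class [2] and the only
-- odd zero-divisor is p, so Γ_E(ℤ_n) has the two vertices [2] and [p]: the empty set
-- does not resolve them, while {[2]} does, since [2] is the only vertex at distance 0.

open import Defs
open import Data.Nat using (ℕ; _*_; _^_; _<_)
open import Data.Nat.Primality using (Prime)
open import Data.Product using (_×_)

open import Data.Nat.Base using (zero; suc; _≤_; z≤n; s≤s; NonZero; ≢-nonZero; ≢-nonZero⁻¹)
open import Data.Nat.Properties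
open import Data.Nat.Divisibility
open import Data.Nat.Primality using (euclidsLemma; prime⇒nonZero; prime[2])
open import Data.Fin using (Fin; toℕ; fromℕ<)
open import Data.Fin.Properties using (toℕ<n; toℕ-fromℕ<)
open import Data.Product using (_,_; proj₁; proj₂)
open import Data.Sum using ([_,_]′)
open import Data.Empty using (⊥-elim)
open import Data.List using ([]; _∷_; [_]; length)
open import Data.List.Relation.Binary.Pointwise using ([]; _∷_)
open import Data.List.Relation.Unary.AllPairs using ([]; _∷_)
open import Data.List.Relation.Unary.All using ([])
open import Data.List.Relation.Binary.Permutation.Propositional using (↭-refl)
open import Data.List.Relation.Binary.Permutation.Propositional.Properties using (↭-singleton-inv)
open import Function using (id; _∘_)
open import Relation.Binary.PropositionalEquality
  using (_≡_; _≢_; refl; sym; trans; cong; subst; subst₂; module ≡-Reasoning)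
open import Relation.Nullary using (¬_; yes; no; contradiction)

module _ {n : ℕ} where

  sameAnn-reflexive : {x y : Fin n} → toℕ x ≡ toℕ y → SameAnn n x y
  sameAnn-reflexive x≡y z = subst (λ t → n ∣ t * toℕ z) x≡y , subst (λ t → n ∣ t * toℕ z) (sym x≡y)

  sameV-sym : {u v : Vtx n} → SameV n u v → SameV n v u
  sameV-sym u~v z = proj₂ (u~v z) , proj₁ (u~v z)

  sameV-trans : {u v w : Vtx n} → SameV n u v → SameV n v w → SameV n u w
  sameV-trans u~v v~w z = proj₁ (v~w z) ∘ proj₁ (u~v z) , proj₂ (u~v z) ∘ proj₂ (v~w z)

  dist0⇒sameV : {u w : Vtx n} → Dist n u w 0 → SameV n u w
  dist0⇒sameV (here u~w , _) = u~w

  sameV⇒dist≡0 : {u w : Vtx n} {d : ℕ} → SameV n u w → Dist n u w d → d ≡ 0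
  sameV⇒dist≡0 {d = zero}  _   _             = refl
  sameV⇒dist≡0 {d = suc _} u~w (_ , minimal) = contradiction (here u~w) (minimal 0 (s≤s z≤n))

  []-mResolving⇒sameV : MResolving n [] → (u v : Vtx n) → SameV n u v
  []-mResolving⇒sameV resolves u v = resolves u v ([] , [] , [] , [] , ↭-refl)

  -- The distance to w is 0 exactly on the class [w], and positive elsewhere.
  singleton-mResolving : (w : Vtx n) →
    (∀ u v → ¬ SameV n u w → ¬ SameV n v w → SameV n u v) → MResolving n [ w ]
  singleton-mResolving w outsideOneClass u v (_ ∷ [] , _ ∷ [] , du ∷ [] , dv ∷ [] , d↭e)
    with refl ← ↭-singleton-inv d↭e = equidistant⇒sameV du dv
    where
    equidistant⇒sameV : {d : ℕ} → Dist n u w d → Dist n v w d → SameV n u v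
    equidistant⇒sameV {zero}  du dv =
      sameV-trans {u} {w} {v} (dist0⇒sameV du) (sameV-sym {v} {w} (dist0⇒sameV dv))
    equidistant⇒sameV {suc _} du dv =
      outsideOneClass u v (λ u~w → 1+n≢0 (sameV⇒dist≡0 u~w du))
                          (λ v~w → 1+n≢0 (sameV⇒dist≡0 v~w dv))

  oneClass⇒MdimIs0 : (∀ u v → SameV n u v) → MdimIs n 0
  oneClass⇒MdimIs0 oneClass = ([] , [] , refl , λ u v _ → oneClass u v) , λ _ _ _ → z≤n

  twoClasses⇒MdimIs1 : (w w′ : Vtx n) → ¬ SameV n w w′ →
    (∀ u v → ¬ SameV n u w → ¬ SameV n v w → SameV n u v) → MdimIs n 1
  twoClasses⇒MdimIs1 w w′ w≁w′ outsideOneClass =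
    ([ w ] , [] ∷ [] , refl , singleton-mResolving w outsideOneClass) , nonempty
    where
    nonempty : ∀ W → IsVertexSet n W → MResolving n W → 1 ≤ length W
    nonempty []      _ resolves = contradiction ([]-mResolving⇒sameV resolves w w′) w≁w′
    nonempty (_ ∷ _) _ _        = s≤s z≤n

module _ {q : ℕ} (q-prime : Prime q) where

  annihilator-of-multiple : ∀ {m x z} → m ∣ x → x ≢ 0 → x < m * q → m * q ∣ x * z → q ∣ z
  annihilator-of-multiple {m} {z = z} (divides-refl a) am≢0 am<mq mq∣amz =
    [ ⊥-elim ∘ q∤a , id ]′ (euclidsLemma a z q-prime q∣az)
    where
    instance
      am-nonZero : NonZero (a * m)
      am-nonZero = ≢-nonZero am≢0
      a-nonZero : NonZero a
      a-nonZero = m*n≢0⇒m≢0 a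
      m-nonZero : NonZero m
      m-nonZero = m*n≢0⇒n≢0 a

    q∣az : q ∣ a * z
    q∣az = *-cancelˡ-∣ m (subst (m * q ∣_) (a*m*z≡m*[a*z]) mq∣amz)
      where
      open ≡-Reasoning
      a*m*z≡m*[a*z] : a * m * z ≡ m * (a * z)
      a*m*z≡m*[a*z] = begin
        a * m * z   ≡⟨ cong (_* z) (*-comm a m) ⟩
        m * a * z   ≡⟨ *-assoc m a z ⟩
        m * (a * z) ∎

    q∤a : ¬ q ∣ a
    q∤a = >⇒∤ (*-cancelˡ-< m a q (subst (_< m * q) (*-comm a m) am<mq))

  sameAnn-of-multiples : ∀ {m} {x y : Fin (m * q)} →
    m ∣ toℕ x → toℕ x ≢ 0 → m ∣ toℕ y → toℕ y ≢ 0 → SameAnn (m * q) x y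
  sameAnn-of-multiples {x = x} {y} m∣x x≢0 m∣y y≢0 z =
    *-pres-∣ m∣y ∘ annihilator-of-multiple m∣x x≢0 (toℕ<n x) ,
    *-pres-∣ m∣x ∘ annihilator-of-multiple m∣y y≢0 (toℕ<n y)

module Square {p : ℕ} (p-prime : Prime p) where

  p∣vertex : (v : Vtx (p * p)) → p ∣ toℕ (elt (p * p) v)
  p∣vertex (x , (y , y≢0 , pp∣xy) , _) =
    [ id , p∣y⇒p∣x ]′ (euclidsLemma (toℕ x) (toℕ y) p-prime (∣-trans (m∣m*n p) pp∣xy))
    where
    p∣y⇒p∣x : p ∣ toℕ y → p ∣ toℕ x
    p∣y⇒p∣x p∣y = annihilator-of-multiple p-prime p∣y y≢0 (toℕ<n y)
                    (subst (p * p ∣_) (*-comm (toℕ x) (toℕ y)) pp∣xy)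

  mdim : MdimIs (p * p) 0
  mdim = oneClass⇒MdimIs0 λ u v →
    sameAnn-of-multiples p-prime (p∣vertex u) (proj₂ (proj₂ u)) (p∣vertex v) (proj₂ (proj₂ v))

p∣x<2p⇒x≡p : ∀ {p x} → p ∣ x → x ≢ 0 → x < 2 * p → x ≡ p
p∣x<2p⇒x≡p     (divides-refl zero)          0≢0 _    = contradiction refl 0≢0
p∣x<2p⇒x≡p {p} (divides-refl 1)             _   _    = *-identityˡ p
p∣x<2p⇒x≡p {p} (divides-refl (suc (suc a))) _   x<2p =
  contradiction (*-monoˡ-≤ p (s≤s (s≤s (z≤n {a})))) (<⇒≱ x<2p)

module TwicePrime {p : ℕ} (p-prime : Prime p) (2<p : 2 < p) where

  instance
    p-nonZero : NonZero p
    p-nonZero = prime⇒nonZero p-prime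

  odd-vertex≡p : (v : Vtx (2 * p)) → ¬ 2 ∣ toℕ (elt (2 * p) v) → toℕ (elt (2 * p) v) ≡ p
  odd-vertex≡p (x , (y , y≢0 , 2p∣xy) , x≢0) x-odd =
    p∣x<2p⇒x≡p (annihilator-of-multiple p-prime 2∣y y≢0 (toℕ<n y) 2p∣yx) x≢0 (toℕ<n x)
    where
    2p∣yx : 2 * p ∣ toℕ y * toℕ x
    2p∣yx = subst (2 * p ∣_) (*-comm (toℕ x) (toℕ y)) 2p∣xy
    2∣y : 2 ∣ toℕ y
    2∣y = [ (λ 2∣x → contradiction 2∣x x-odd) , id ]′
            (euclidsLemma (toℕ x) (toℕ y) prime[2] (∣-trans (m∣m*n p) 2p∣xy))

  2<2p : 2 < 2 * p
  2<2p = <-≤-trans 2<p (m≤n*m p 2)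

  p<2p : p < 2 * p
  p<2p = subst (p <_) (*-comm p 2) (m<m*n p 2 (s≤s (s≤s z≤n)))

  twoFin pFin : Fin (2 * p)
  twoFin = fromℕ< 2<2p
  pFin   = fromℕ< p<2p

  toℕ-twoFin : toℕ twoFin ≡ 2
  toℕ-twoFin = toℕ-fromℕ< 2<2p

  toℕ-pFin : toℕ pFin ≡ p
  toℕ-pFin = toℕ-fromℕ< p<2p

  twoFin≢0 : toℕ twoFin ≢ 0
  twoFin≢0 twoFin≡0 = contradiction (trans (sym toℕ-twoFin) twoFin≡0) λ ()

  pFin≢0 : toℕ pFin ≢ 0
  pFin≢0 pFin≡0 = contradiction (trans (sym toℕ-pFin) pFin≡0) (≢-nonZero⁻¹ p)

  2p∣twoFin*pFin : 2 * p ∣ toℕ twoFin * toℕ pFin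
  2p∣twoFin*pFin = subst₂ (λ a b → 2 * p ∣ a * b) (sym toℕ-twoFin) (sym toℕ-pFin) ∣-refl

  2p∣pFin*twoFin : 2 * p ∣ toℕ pFin * toℕ twoFin
  2p∣pFin*twoFin = subst (2 * p ∣_) (*-comm (toℕ twoFin) (toℕ pFin)) 2p∣twoFin*pFin

  v₂ vₚ : Vtx (2 * p)
  v₂ = twoFin , (pFin , pFin≢0 , 2p∣twoFin*pFin) , twoFin≢0
  vₚ = pFin , (twoFin , twoFin≢0 , 2p∣pFin*twoFin) , pFin≢0

  -- 2 ∈ ann(p) but 2 ∉ ann(2), as 2p ∤ 4 when p > 2.
  v₂≁vₚ : ¬ SameV (2 * p) v₂ vₚ
  v₂≁vₚ v₂~vₚ = <⇒≱ 2<p (∣⇒≤ (*-cancelˡ-∣ 2 2p∣2*2))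
    where
    2p∣2*2 : 2 * p ∣ 2 * 2
    2p∣2*2 = subst (λ a → 2 * p ∣ a * a) toℕ-twoFin (proj₂ (v₂~vₚ twoFin) 2p∣pFin*twoFin)

  even-vertex~v₂ : (v : Vtx (2 * p)) → 2 ∣ toℕ (elt (2 * p) v) → SameV (2 * p) v v₂
  even-vertex~v₂ v 2∣v = sameAnn-of-multiples p-prime 2∣v (proj₂ (proj₂ v))
                           (subst (2 ∣_) (sym toℕ-twoFin) ∣-refl) twoFin≢0

  outside-[2]⇒≡p : (v : Vtx (2 * p)) → ¬ SameV (2 * p) v v₂ → toℕ (elt (2 * p) v) ≡ p
  outside-[2]⇒≡p v v≁v₂ with 2 ∣? toℕ (elt (2 * p) v)
  ... | yes 2∣v = contradiction (even-vertex~v₂ v 2∣v) v≁v₂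
  ... | no  2∤v = odd-vertex≡p v 2∤v

  mdim : MdimIs (2 * p) 1
  mdim = twoClasses⇒MdimIs1 v₂ vₚ v₂≁vₚ λ u v u≁v₂ v≁v₂ →
    sameAnn-reflexive (trans (outside-[2]⇒≡p u u≁v₂) (sym (outside-[2]⇒≡p v v≁v₂)))

proposition3p3 : ∀ (p : ℕ) → Prime p →
    (2 < p → MdimIs (2 * p) 1) × MdimIs (p ^ 2) 0
proposition3p3 p p-prime =
  TwicePrime.mdim p-prime ,
  subst (λ n → MdimIs n 0) (cong (p *_) (sym (*-identityʳ p))) (Square.mdim p-prime)
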